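{- Let $w=w_0w_1\cdots w_{n-1}$ be the lattice word of an $r$-row non-skew fluctuating tableau of type $\underline c=(c_1,\ldots,c_n)$ with $|c_1|=1$. Suppose $e_{i_1},\ldots,e_{i_k}$ is a sequence of raising operators which, applied successively (each application nonzero) to the word $w_1\cdots w_{n-1}$, produces a highest weight word $w'_1\cdots w'_{n-1}$, where the $h$-th operator $e_{i_h}$ acts on the letter in position $j_h$ (positions numbered as in $w$). Let $w'_n$ be the unique singleton subset of $\{1,\ldots,r\}$ if $c_1=1$, resp. of $\{ -1,\ldots,-r\}$ if $c_1=-1$, such that $\mathrm{wt}(w_0\cdots w_{n-1})=\mathrm{wt}(w'_1\cdots w'_n)$. Then: - if $c_1=1$, then $(i_1,\ldots,i_k)=(1,2,\ldots,k)$ and $w'_n=\{k+1\}$; - if $c_1=-1$, then $(i_1,\ldots,i_k)=(r-1,r-2,\ldots,r-k)$ and $w'_n=\{ -(r-k)\}$. Set $j_0:=0$, and $i_{k+1}:=k+1$ if $c_1=1$, $i_{k+1}:=r-k-1$ if $c_1=-1$. Then for each $1\le h\le k$, $j_h$ is the first $i_h$-balance point of $w$ weakly after $j_{h-1}$, and, provided $1\le i_{k+1}\le r-1$, there is no $i_{k+1}$-balance point of $w$ weakly after $j_k$. In particular $1\le j_1\le\cdots\le j_k\le n-1$, and if the fluctuating tableau is rectangular then $k=r-1$.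
   Context: Let $\mathcal A_r$ be the set of subsets $S\subseteq\{\pm1,\ldots,\pm r\}$ with all elements of the same sign (including $\emptyset$); $\mathbf e_S=\sum_{s\in S}\mathbf e_s$ if $S$ is positive and $\mathbf e_S=-\sum_{s\in S}\mathbf e_{ -s}$ if negative. An $r$-row non-skew fluctuating tableau of length $n$ is a sequence $0=\lambda^0,\lambda^1,\ldots,\lambda^n$ of weakly decreasing integer vectors in $\mathbb Z^r$ with $\lambda^k=\lambda^{k-1}+\mathbf e_{S_k}$, $S_k\in\mathcal A_r$; its type has $c_k=\pm|S_k|$ with the sign of $S_k$, its lattice word is $S_1S_2\cdots S_n$ (here 0-indexed as $w_0\cdots w_{n-1}$), and it is rectangular if all parts of $\lambda^n$ are equal. The weight of a word $u_1\cdots u_m$ in $\mathcal A_r$ is $\sum_k\mathbf e_{u_k}$. Crystal operators (bracketing rule), for $1\le i\le r-1$ on words in $\mathcal A_r$: write "[" under each letter containing $i$ but not $i+1$, or containing $-(i+1)$ but not $-i$; write "]" under each letter containing $i+1$ but not $i$, or containing $-i$ but not $-(i+1)$; match brackets from the inside out (a "[" with the nearest following unmatched "]"). $e_i$ acts on the letter carrying the rightmost unmatched "]" by replacing $i+1$ with $i$, or $-i$ with $-(i+1)$; if there is no unmatched "]", $e_i$ gives $0$. A word is highest weight if $e_i$ gives $0$ for all $1\le i\le r-1$. For the lattice word $w_0\cdots w_{n-1}$, an index $0\le j\le n-1$ is an $i$-balance point ($1\le i\le r-1$) if in $w_0\cdots w_j$ the number of letters containing $i$ minus the number containing $-i$ equals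 the number containing $i+1$ minus the number containing $-(i+1)$. -}

module Defs where

open import Data.Bool using (Bool; true; false; _∧_; _∨_; not; if_then_else_)
open import Data.Nat using (ℕ; zero; suc; _≤_; _<_)
open import Data.Integer as ℤ using (ℤ; +_; -[1+_])
open import Data.List using (List; []; _∷_; take; length; map; sum)
open import Data.Maybe using (Maybe; just; nothing)
open import Data.Vec using (Vec; []; _∷_; replicate)
open import Data.Product using (_×_; _,_; proj₁; proj₂)
open import Relation.Binary.PropositionalEquality using (_≡_)
open import Relation.Nullary using (¬_)
open import Data.Unit using (⊤)

-- Subsets of {1,…,r} as bit vectors, accessed with 1-based ℕ indices.

mem : ∀ {r} → Vec Bool r → ℕ → Bool
mem [] _ = false
mem (b ∷ v) zero = false
mem (b ∷ v) (suc zero) = b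
mem (b ∷ v) (suc (suc k)) = mem v (suc k)

upd : ∀ {r} → Vec Bool r → ℕ → Bool → Vec Bool r
upd [] _ _ = []
upd (b ∷ v) zero c = b ∷ v
upd (b ∷ v) (suc zero) c = c ∷ v
upd (b ∷ v) (suc (suc k)) c = b ∷ upd v (suc k) c

card : ∀ {r} → Vec Bool r → ℕ
card [] = 0
card (true ∷ v) = suc (card v)
card (false ∷ v) = card v

-- Letters of 𝒜_r: a sign (true = positive, false = negative) and a
-- subset T ⊆ {1,…,r}; the letter is T (positive) or -T (negative).
-- (The empty set has two harmless representations.)

Letter : ℕ → Set
Letter r = Bool × Vec Bool r

has : ∀ {r} → Letter r → ℕ → Bool
has (s , v) i = s ∧ mem v i

hasNeg : ∀ {r} → Letter r → ℕ → Bool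
hasNeg (s , v) i = not s ∧ mem v i

single⁺ : ∀ r → ℕ → Letter r
single⁺ r m = true , upd (replicate r false) m true

single⁻ : ∀ r → ℕ → Letter r
single⁻ r m = false , upd (replicate r false) m true

coord : ∀ {r} → Letter r → ℕ → ℤ
coord x i = if has x i then + 1 else (if hasNeg x i then -[1+ 0 ] else + 0)

wtc : ∀ {r} → List (Letter r) → ℕ → ℤ
wtc [] i = + 0
wtc (x ∷ xs) i = coord x i ℤ.+ wtc xs i

WtEq : ∀ r → List (Letter r) → List (Letter r) → Set
WtEq r u v = ∀ i → 1 ≤ i → i ≤ r → wtc u i ≡ wtc v i

-- Lattice words of r-row non-skew fluctuating tableaux:
-- every partial sum λ^m = wt(w_0 ⋯ w_{m-1}) is weakly decreasing.

Dominant : ∀ r → List (Letter r) → Set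
Dominant r u = ∀ i → 1 ≤ i → i < r → wtc u (suc i) ℤ.≤ wtc u i

IsLatticeWord : ∀ r → List (Letter r) → Set
IsLatticeWord r w = ∀ m → m ≤ length w → Dominant r (take m w)

Rectangular : ∀ r → List (Letter r) → Set
Rectangular r w = ∀ i → 1 ≤ i → i < r → wtc w i ≡ wtc w (suc i)

opens : ∀ {r} → Letter r → ℕ → Bool
opens x i = (has x i ∧ not (has x (suc i))) ∨ (hasNeg x (suc i) ∧ not (hasNeg x i))

closes : ∀ {r} → Letter r → ℕ → Bool
closes x i = (has x (suc i) ∧ not (has x i)) ∨ (hasNeg x i ∧ not (hasNeg x (suc i)))

-- Left-to-right scan: d = number of currently unmatched "[", p = current
-- position, best = position of the rightmost unmatched "]" seen so far.
-- A "]" is unmatched iff no "[" is unmatched when it is reached (this is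
-- the same as matching from the inside out).
mutual
  scan : ∀ {r} → ℕ → ℕ → ℕ → Maybe ℕ → List (Letter r) → Maybe ℕ
  scan i d p best [] = best
  scan i d p best (x ∷ xs) =
    if opens x i then scan i (suc d) (suc p) best xs
    else (if closes x i then closeStep i d p best xs
          else scan i d (suc p) best xs)

  closeStep : ∀ {r} → ℕ → ℕ → ℕ → Maybe ℕ → List (Letter r) → Maybe ℕ
  closeStep i zero p best xs = scan i zero (suc p) (just p) xs
  closeStep i (suc d) p best xs = scan i d (suc p) best xs

-- position (0-based) of the letter carrying the rightmost unmatched "]"
rightmostUnmatched : ∀ {r} → ℕ → List (Letter r) → Maybe ℕ
rightmostUnmatched i u = scan i 0 0 nothing u

raiseLetter : ∀ {r} → ℕ → Letter r → Letter r
raiseLetter i (true , v) = true , upd (upd v (suc i) false) i true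
raiseLetter i (false , v) = false , upd (upd v i false) (suc i) true

modifyAt : ∀ {A : Set} → ℕ → (A → A) → List A → List A
modifyAt p f [] = []
modifyAt zero f (x ∷ xs) = f x ∷ xs
modifyAt (suc p) f (x ∷ xs) = x ∷ modifyAt p f xs

-- e_i u : nothing means 0; otherwise (position acted on , resulting word)
applyE : ∀ {r} → ℕ → List (Letter r) → Maybe (ℕ × List (Letter r))
applyE i u with rightmostUnmatched i u
... | nothing = nothing
... | just p = just (p , modifyAt p (raiseLetter i) u)

HighestWeight : ∀ r → List (Letter r) → Set
HighestWeight r u = ∀ i → 1 ≤ i → i < r → applyE i u ≡ nothing

-- RaisingSeq r u ops v : applying e_{i_1}, …, e_{i_k} successively to u
-- (each nonzero) yields v, where ops = ((i_1 , j_1) , … , (i_k , j_k)) and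
-- j_h is the position acted upon, numbered with offset 1 (u is the word
-- w_1 ⋯ w_{n-1}, positions numbered as in w = w_0 ⋯ w_{n-1}).
data RaisingSeq (r : ℕ) : List (Letter r) → List (ℕ × ℕ) → List (Letter r) → Set where
  done : ∀ {u} → RaisingSeq r u [] u
  step : ∀ {u u' v i p ops} → 1 ≤ i → i < r →
         applyE i u ≡ just (p , u') →
         RaisingSeq r u' ops v →
         RaisingSeq r u ((i , suc p) ∷ ops) v

IsBalance : ∀ {r} → List (Letter r) → ℕ → ℕ → Set
IsBalance w i j = j < length w × wtc (take (suc j) w) i ≡ wtc (take (suc j) w) (suc i)

FirstBalanceAfter : ∀ {r} → List (Letter r) → ℕ → ℕ → ℕ → Set
FirstBalanceAfter w i a j =
  a ≤ j × IsBalance w i j × (∀ j' → a ≤ j' → j' < j → ¬ IsBalance w i j')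

BalanceChain : ∀ r → List (Letter r) → ℕ → List (ℕ × ℕ) → ℕ → Set
BalanceChain r w prev [] iNext =
  1 ≤ iNext → iNext < r → ∀ j → prev ≤ j → ¬ IsBalance w iNext j
BalanceChain r w prev ((i , j) ∷ ops) iNext =
  FirstBalanceAfter w i prev j × BalanceChain r w j ops iNext

Sorted : ℕ → ℕ → List (ℕ × ℕ) → Set
Sorted n prev [] = ⊤
Sorted n prev ((i , j) ∷ ops) = prev ≤ j × j < n × Sorted n j ops

-- Carry w₀ along as a letter x "moved to the end of the word": as long as, from the last
-- raised position a on, the prefixes of w weigh as much as the prefixes of the current word u
-- plus x, the i-depth (number of "[" minus number of "]") of a prefix of u is that of the
-- corresponding prefix of w minus the bracket of x. Lattice words have nonnegative depths, so
-- e_i u = 0 unless x opens at i, and a singleton {±c} opens at exactly one index. There the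
-- rightmost unmatched "]" of u is where its depth first drops to -1, i.e. at the first
-- i-balance point of w after a; raising it moves the root α_i from x into u, so x becomes the
-- next singleton, {c+1} resp. {-(c-1)}, and the argument repeats. The word is highest weight
-- once no balance point is left for the current index.

module Submission where

open import Defs
open import Data.Bool using (Bool; true; false; if_then_else_)
open import Data.Nat as ℕ using (ℕ; zero; suc; _+_; _∸_; _≤_; _<_; z≤n; s≤s; _≡ᵇ_)
import Data.Nat.Properties as ℕP
open import Data.Integer as ℤ using (ℤ; +_; -[1+_]; +≤+; -≤-; -≤+; 0ℤ; -1ℤ)
import Data.Integer.Properties as ℤP
open import Data.Integer.Solver using (module +-*-Solver)
open import Data.List using (List; []; _∷_; take; length; map; _++_; upTo; applyUpTo)
open import Data.List.Properties using (take-all; map-applyUpTo)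
open import Data.Maybe using (just; nothing)
open import Data.Maybe.Properties using (just-injective)
open import Data.Vec using (Vec; []; _∷_; replicate)
open import Data.Product using (_×_; _,_; proj₁; proj₂; ∃-syntax)
open import Data.Sum using (_⊎_; inj₁; inj₂; [_,_]′)
open import Data.Empty using (⊥; ⊥-elim)
open import Relation.Binary.PropositionalEquality
open import Relation.Nullary using (¬_; yes; no; contradiction)
open import Relation.Unary using (Decidable)
open import Function using (_∘_)

open +-*-Solver

bracket : ∀ {r} → Letter r → ℕ → ℤ
bracket x i = if opens x i then + 1 else (if closes x i then -1ℤ else 0ℤ)

bracket≡coord-difference : ∀ {r} (x : Letter r) i → bracket x i ≡ coord x i ℤ.- coord x (suc i)
bracket≡coord-difference (true , v) i with mem v i | mem v (suc i)
... | true  | true  = refl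
... | true  | false = refl
... | false | true  = refl
... | false | false = refl
bracket≡coord-difference (false , v) i with mem v i | mem v (suc i)
... | true  | true  = refl
... | true  | false = refl
... | false | true  = refl
... | false | false = refl

bracket-opens : ∀ {r} (x : Letter r) i → opens x i ≡ true → bracket x i ≡ + 1
bracket-opens x i eo rewrite eo = refl

bracket-closes : ∀ {r} (x : Letter r) i → opens x i ≡ false → closes x i ≡ true → bracket x i ≡ -1ℤ
bracket-closes x i eo ec rewrite eo | ec = refl

bracket-neither : ∀ {r} (x : Letter r) i → opens x i ≡ false → closes x i ≡ false → bracket x i ≡ 0ℤ
bracket-neither x i eo ec rewrite eo | ec = refl

bracket≤0 : ∀ {r} (x : Letter r) i → opens x i ≡ false → bracket x i ℤ.≤ 0ℤ
bracket≤0 x i eo rewrite eo with closes x i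
... | true  = -≤+
... | false = ℤP.≤-refl

depth : ∀ {r} → ℕ → List (Letter r) → ℤ
depth i u = wtc u i ℤ.- wtc u (suc i)

depth-∷ : ∀ {r} i (x : Letter r) u → depth i (x ∷ u) ≡ bracket x i ℤ.+ depth i u
depth-∷ i x u = begin
  (coord x i ℤ.+ wtc u i) ℤ.- (coord x (suc i) ℤ.+ wtc u (suc i))
    ≡⟨ solve 4 (λ a b c d → (a :+ c) :- (b :+ d) := (a :- b) :+ (c :- d)) refl
         (coord x i) (coord x (suc i)) (wtc u i) (wtc u (suc i)) ⟩
  (coord x i ℤ.- coord x (suc i)) ℤ.+ depth i u
    ≡⟨ cong (ℤ._+ depth i u) (sym (bracket≡coord-difference x i)) ⟩
  bracket x i ℤ.+ depth i u ∎
  where open ≡-Reasoning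

offset-depth-∷ : ∀ {r} c i (x : Letter r) u → c ℤ.+ depth i (x ∷ u) ≡ (bracket x i ℤ.+ c) ℤ.+ depth i u
offset-depth-∷ c i x u = trans (cong (λ d → c ℤ.+ d) (depth-∷ i x u))
  (solve 3 (λ c b d → c :+ (b :+ d) := (b :+ c) :+ d) refl c (bracket x i) (depth i u))

DepthsAbove : ∀ {r} → ℤ → ℤ → ℕ → List (Letter r) → Set
DepthsAbove b c i u = ∀ m → m ≤ length u → b ℤ.≤ c ℤ.+ depth i (take m u)

FirstDip : ∀ {r} → ℤ → ℕ → List (Letter r) → ℕ → Set
FirstDip c i u t = t < length u × c ℤ.+ depth i (take (suc t) u) ≡ -1ℤ
  × (∀ t' → t' < t → c ℤ.+ depth i (take (suc t') u) ≢ -1ℤ)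

depthsAbove-∷ : ∀ {r} {b₀ b i} c (x : Letter r) u → bracket x i ≡ b →
  DepthsAbove b₀ c i (x ∷ u) → DepthsAbove b₀ (b ℤ.+ c) i u
depthsAbove-∷ {i = i} c x u refl H m m≤ =
  subst (_ ℤ.≤_) (offset-depth-∷ c i x (take m u)) (H (suc m) (s≤s m≤))

firstDip-∷ : ∀ {r} {b i} c (x : Letter r) u {t} → bracket x i ≡ b →
  FirstDip c i (x ∷ u) (suc t) → FirstDip (b ℤ.+ c) i u t
firstDip-∷ {i = i} c x u {t} refl (s≤s t< , dip , before) =
  t< , trans (sym (offset-depth-∷ c i x (take (suc t) u))) dip ,
  λ t' t'< → before (suc t') (s≤s t'<) ∘ trans (offset-depth-∷ c i x (take (suc t') u))

firstDip-head : ∀ {r} {b i} c (x : Letter r) u → bracket x i ≡ b → FirstDip c i (x ∷ u) 0 → b ℤ.+ c ≡ -1ℤ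
firstDip-head {i = i} c x u refl (_ , dip , _) =
  trans (sym (ℤP.+-identityʳ _)) (trans (sym (offset-depth-∷ c i x [])) dip)

-- The count d of unmatched "[" kept by scan enters as the shift + d of the depth.
scan-no-dip : ∀ {r} i (u : List (Letter r)) d q best → DepthsAbove 0ℤ (+ d) i u → scan i d q best u ≡ best
scan-no-dip i []      d q best H = refl
scan-no-dip i (x ∷ u) d q best H with opens x i in eo | closes x i in ec
... | true  | _     = scan-no-dip i u (suc d) (suc q) best (depthsAbove-∷ (+ d) x u (bracket-opens x i eo) H)
... | false | false = scan-no-dip i u d (suc q) best (depthsAbove-∷ (+ d) x u (bracket-neither x i eo ec) H)
scan-no-dip i (x ∷ u) (suc d) q best H | false | true =
  scan-no-dip i u d (suc q) best (depthsAbove-∷ (+ suc d) x u (bracket-closes x i eo ec) H)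
scan-no-dip i (x ∷ u) zero q best H | false | true
  with depthsAbove-∷ 0ℤ x u (bracket-closes x i eo ec) H 0 z≤n
... | ()

-1≤-1+z⇒0≤z : ∀ z → -1ℤ ℤ.≤ -1ℤ ℤ.+ z → 0ℤ ℤ.≤ 0ℤ ℤ.+ z
-1≤-1+z⇒0≤z (+ n)      _         = +≤+ z≤n
-1≤-1+z⇒0≤z -[1+ n ] (-≤- ())

scan-first-dip : ∀ {r} i (u : List (Letter r)) d q best t →
  DepthsAbove -1ℤ (+ d) i u → FirstDip (+ d) i u t → scan i d q best u ≡ just (q + t)
scan-first-dip i (x ∷ u) d q best t H D with opens x i in eo | closes x i in ec
scan-first-dip i (x ∷ u) d q best zero H D | true | _ with firstDip-head (+ d) x u (bracket-opens x i eo) D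
... | ()
scan-first-dip i (x ∷ u) d q best (suc t) H D | true | _ =
  trans (scan-first-dip i u (suc d) (suc q) best t (depthsAbove-∷ (+ d) x u eb H) (firstDip-∷ (+ d) x u eb D))
        (cong just (sym (ℕP.+-suc q t)))
  where eb = bracket-opens x i eo
scan-first-dip i (x ∷ u) d q best zero H D | false | false with firstDip-head (+ d) x u (bracket-neither x i eo ec) D
... | ()
scan-first-dip i (x ∷ u) d q best (suc t) H D | false | false =
  trans (scan-first-dip i u d (suc q) best t (depthsAbove-∷ (+ d) x u eb H) (firstDip-∷ (+ d) x u eb D))
        (cong just (sym (ℕP.+-suc q t)))
  where eb = bracket-neither x i eo ec
scan-first-dip i (x ∷ u) (suc d) q best zero H D | false | true with firstDip-head (+ suc d) x u (bracket-closes x i eo ec) D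
... | ()
scan-first-dip i (x ∷ u) (suc d) q best (suc t) H D | false | true =
  trans (scan-first-dip i u d (suc q) best t (depthsAbove-∷ (+ suc d) x u eb H) (firstDip-∷ (+ suc d) x u eb D))
        (cong just (sym (ℕP.+-suc q t)))
  where eb = bracket-closes x i eo ec
scan-first-dip i (x ∷ u) zero q best zero H D | false | true =
  trans (scan-no-dip i u 0 (suc q) (just q) λ m m≤ → -1≤-1+z⇒0≤z (depth i (take m u)) (H′ m m≤))
        (cong just (sym (ℕP.+-identityʳ q)))
  where
    H′ : DepthsAbove -1ℤ -1ℤ i u
    H′ = depthsAbove-∷ 0ℤ x u (bracket-closes x i eo ec) H
scan-first-dip i (x ∷ u) zero q best (suc t) H (_ , _ , before) | false | true =
  ⊥-elim (before 0 (s≤s z≤n)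
    (trans (offset-depth-∷ 0ℤ i x []) (cong (λ b → (b ℤ.+ 0ℤ) ℤ.+ 0ℤ) (bracket-closes x i eo ec))))

applyE-no-dip : ∀ {r} i (u : List (Letter r)) → DepthsAbove 0ℤ 0ℤ i u → applyE i u ≡ nothing
applyE-no-dip i u H rewrite scan-no-dip i u 0 0 nothing H = refl

applyE-first-dip : ∀ {r} i (u : List (Letter r)) t → DepthsAbove -1ℤ 0ℤ i u → FirstDip 0ℤ i u t →
  applyE i u ≡ just (t , modifyAt t (raiseLetter i) u)
applyE-first-dip i u t H D rewrite scan-first-dip i u 0 0 nothing t H D = refl

ClosesAt : ∀ {r} → ℕ → ℕ → List (Letter r) → Set
ClosesAt i t       []      = ⊥
ClosesAt i zero    (x ∷ u) = closes x i ≡ true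
ClosesAt i (suc t) (x ∷ u) = ClosesAt i t u

bracket-nonneg : ∀ {r} (x : Letter r) i → closes x i ≡ false → 0ℤ ℤ.≤ bracket x i
bracket-nonneg x i ec rewrite ec with opens x i
... | true  = +≤+ z≤n
... | false = +≤+ z≤n

nonneg+nonneg≢-1 : ∀ {a b} → 0ℤ ℤ.≤ a → 0ℤ ℤ.≤ b → a ℤ.+ b ≢ -1ℤ
nonneg+nonneg≢-1 ha hb e = contradiction (subst (0ℤ ℤ.≤_) e (ℤP.+-mono-≤ ha hb)) λ ()

-1≤z⇒z≢-1⇒0≤z : ∀ z → -1ℤ ℤ.≤ z → z ≢ -1ℤ → 0ℤ ℤ.≤ z
-1≤z⇒z≢-1⇒0≤z (+ n)          _ _  = +≤+ z≤n
-1≤z⇒z≢-1⇒0≤z -[1+ zero ]    _ ne = contradiction refl ne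
-1≤z⇒z≢-1⇒0≤z -[1+ suc n ] (-≤- ()) _

dip-closes : ∀ {r} i (u : List (Letter r)) t c → 0ℤ ℤ.≤ c ℤ.+ depth i (take t u) →
  c ℤ.+ depth i (take (suc t) u) ≡ -1ℤ → ClosesAt i t u
dip-closes i []      zero    c h e = contradiction (subst (0ℤ ℤ.≤_) e h) λ ()
dip-closes i []      (suc t) c h e = contradiction (subst (0ℤ ℤ.≤_) e h) λ ()
dip-closes i (x ∷ u) zero    c h e with closes x i in ec
... | true  = refl
... | false = contradiction
  (trans (sym (ℤP.+-assoc (bracket x i) c 0ℤ)) (trans (sym (offset-depth-∷ c i x [])) e))
  (nonneg+nonneg≢-1 (bracket-nonneg x i ec) h)
dip-closes i (x ∷ u) (suc t) c h e =
  dip-closes i u t (bracket x i ℤ.+ c) (subst (0ℤ ℤ.≤_) (offset-depth-∷ c i x (take t u)) h)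
    (trans (sym (offset-depth-∷ c i x (take (suc t) u))) e)

firstDip-nonneg-before : ∀ {r} {i} {u : List (Letter r)} {t} → DepthsAbove -1ℤ 0ℤ i u → FirstDip 0ℤ i u t →
  ∀ m → m ≤ t → 0ℤ ℤ.≤ 0ℤ ℤ.+ depth i (take m u)
firstDip-nonneg-before H D zero    _  = ℤP.≤-refl
firstDip-nonneg-before H (t< , _ , before) (suc m) m<t =
  -1≤z⇒z≢-1⇒0≤z _ (H (suc m) (ℕP.≤-trans m<t (ℕP.<⇒≤ t<))) (before m m<t)

firstDip-closes : ∀ {r} i (u : List (Letter r)) t → DepthsAbove -1ℤ 0ℤ i u → FirstDip 0ℤ i u t → ClosesAt i t u
firstDip-closes i u t H D = dip-closes i u t 0ℤ (firstDip-nonneg-before H D t ℕP.≤-refl) (proj₁ (proj₂ D))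

mem-upd-same : ∀ {r} (v : Vec Bool r) a b → 1 ≤ a → a ≤ r → mem (upd v a b) a ≡ b
mem-upd-same (_ ∷ v) (suc zero)    b _ _         = refl
mem-upd-same (_ ∷ v) (suc (suc a)) b _ (s≤s a≤) = mem-upd-same v (suc a) b (s≤s z≤n) a≤

mem-upd-other : ∀ {r} (v : Vec Bool r) a b c → a ≢ c → mem (upd v a b) c ≡ mem v c
mem-upd-other []      a             b c             _  = refl
mem-upd-other (_ ∷ v) zero          b c             _  = refl
mem-upd-other (_ ∷ v) (suc zero)    b zero          _  = refl
mem-upd-other (_ ∷ v) (suc zero)    b (suc zero)    ne = contradiction refl ne
mem-upd-other (_ ∷ v) (suc zero)    b (suc (suc c)) _  = refl
mem-upd-other (_ ∷ v) (suc (suc a)) b zero          _  = refl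
mem-upd-other (_ ∷ v) (suc (suc a)) b (suc zero)    _  = refl
mem-upd-other (_ ∷ v) (suc (suc a)) b (suc (suc c)) ne = mem-upd-other v (suc a) b (suc c) (ne ∘ cong suc)

mem-replicate : ∀ r c → mem (replicate r false) c ≡ false
mem-replicate zero    c             = refl
mem-replicate (suc r) zero          = refl
mem-replicate (suc r) (suc zero)    = refl
mem-replicate (suc r) (suc (suc c)) = mem-replicate r (suc c)

basis : ℕ → ℕ → ℤ
basis a l = if a ≡ᵇ l then + 1 else 0ℤ

basis-same : ∀ a → basis a a ≡ + 1
basis-same zero    = refl
basis-same (suc a) = basis-same a

basis-other : ∀ {a l} → a ≢ l → basis a l ≡ 0ℤ
basis-other {zero}  {zero}  ne = contradiction refl ne
basis-other {zero}  {suc l} _  = refl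
basis-other {suc a} {zero}  _  = refl
basis-other {suc a} {suc l} ne = basis-other (ne ∘ cong suc)

root : ℕ → ℕ → ℤ
root i l = basis i l ℤ.- basis (suc i) l

coord-single⁺ : ∀ {r a} → 1 ≤ a → a ≤ r → ∀ l → coord (single⁺ r a) l ≡ basis a l
coord-single⁺ {r} {a} 1≤a a≤r l with l ℕ.≟ a
... | yes refl rewrite mem-upd-same (replicate r false) a true 1≤a a≤r | basis-same a = refl
... | no l≢a rewrite mem-upd-other (replicate r false) a true l (l≢a ∘ sym) | mem-replicate r l
                   | basis-other (l≢a ∘ sym) = refl

coord-negate : ∀ {r} (v : Vec Bool r) l → coord (false , v) l ≡ ℤ.- coord (true , v) l
coord-negate v l with mem v l
... | true  = refl
... | false = refl

coord-single⁻ : ∀ {r a} → 1 ≤ a → a ≤ r → ∀ l → coord (single⁻ r a) l ≡ ℤ.- basis a l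
coord-single⁻ {r} {a} 1≤a a≤r l =
  trans (coord-negate (upd (replicate r false) a true) l) (cong ℤ.-_ (coord-single⁺ 1≤a a≤r l))

coord-move : ∀ {r} (v : Vec Bool r) {a b} l → 1 ≤ a → a ≤ r → 1 ≤ b → b ≤ r → a ≢ b →
  mem v a ≡ false → mem v b ≡ true →
  coord (true , upd (upd v b false) a true) l ≡ coord (true , v) l ℤ.+ (basis a l ℤ.- basis b l)
coord-move v {a} {b} l 1≤a a≤r 1≤b b≤r a≢b ma mb with l ℕ.≟ a | l ℕ.≟ b
... | yes refl | _
  rewrite mem-upd-same (upd v b false) a true 1≤a a≤r | ma | basis-same a | basis-other (a≢b ∘ sym) = refl
... | no l≢a | yes refl
  rewrite mem-upd-other (upd v b false) a true b a≢b | mem-upd-same v b false 1≤b b≤r | mb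
        | basis-same b | basis-other (l≢a ∘ sym) = refl
... | no l≢a | no l≢b
  rewrite mem-upd-other (upd v b false) a true l (l≢a ∘ sym) | mem-upd-other v b false l (l≢b ∘ sym)
        | basis-other (l≢a ∘ sym) | basis-other (l≢b ∘ sym) = sym (ℤP.+-identityʳ _)

coord-raiseLetter : ∀ {r} i (x : Letter r) l → 1 ≤ i → i < r → closes x i ≡ true →
  coord (raiseLetter i x) l ≡ coord x l ℤ.+ root i l
coord-raiseLetter i (true , v) l 1≤i i<r ec with mem v i in mi | mem v (suc i) in mi₁
coord-raiseLetter i (true , v) l 1≤i i<r () | true  | true
coord-raiseLetter i (true , v) l 1≤i i<r () | true  | false
coord-raiseLetter i (true , v) l 1≤i i<r () | false | false
... | false | true = coord-move v l 1≤i (ℕP.<⇒≤ i<r) (s≤s z≤n) i<r (ℕP.1+n≢n ∘ sym) mi mi₁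
coord-raiseLetter i (false , v) l 1≤i i<r ec with mem v i in mi | mem v (suc i) in mi₁
coord-raiseLetter i (false , v) l 1≤i i<r () | true  | true
coord-raiseLetter i (false , v) l 1≤i i<r () | false | true
coord-raiseLetter i (false , v) l 1≤i i<r () | false | false
... | true | false = begin
  coord (false , v') l                                   ≡⟨ coord-negate v' l ⟩
  ℤ.- coord (true , v') l
    ≡⟨ cong ℤ.-_ (coord-move v l (s≤s z≤n) i<r 1≤i (ℕP.<⇒≤ i<r) ℕP.1+n≢n mi₁ mi) ⟩
  ℤ.- (coord (true , v) l ℤ.+ (basis (suc i) l ℤ.- basis i l))
    ≡⟨ solve 3 (λ c a b → :- (c :+ (b :- a)) := :- c :+ (a :- b)) refl
         (coord (true , v) l) (basis i l) (basis (suc i) l) ⟩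
  ℤ.- coord (true , v) l ℤ.+ root i l                    ≡⟨ cong (ℤ._+ root i l) (sym (coord-negate v l)) ⟩
  coord (false , v) l ℤ.+ root i l ∎
  where
    open ≡-Reasoning
    v' = upd (upd v i false) (suc i) true

take-modifyAt : ∀ {A : Set} (f : A → A) (u : List A) {t m} → m ≤ t → take m (modifyAt t f u) ≡ take m u
take-modifyAt f u       {m = zero}  _         = refl
take-modifyAt f []      {m = suc m} _         = refl
take-modifyAt f (x ∷ u) {suc t} {suc m} (s≤s m≤t) = cong (x ∷_) (take-modifyAt f u m≤t)

length-modifyAt : ∀ {A : Set} (f : A → A) (u : List A) t → length (modifyAt t f u) ≡ length u
length-modifyAt f []      t       = refl
length-modifyAt f (x ∷ u) zero    = refl
length-modifyAt f (x ∷ u) (suc t) = cong suc (length-modifyAt f u t)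

wtc-take-raise : ∀ {r} i (u : List (Letter r)) {t m} l → 1 ≤ i → i < r → ClosesAt i t u → t < m →
  wtc (take m (modifyAt t (raiseLetter i) u)) l ≡ wtc (take m u) l ℤ.+ root i l
wtc-take-raise i (x ∷ u) {zero} {suc m} l 1≤i i<r cl _ rewrite coord-raiseLetter i x l 1≤i i<r cl =
  solve 3 (λ c a w → (c :+ a) :+ w := (c :+ w) :+ a) refl (coord x l) (root i l) (wtc (take m u) l)
wtc-take-raise i (x ∷ u) {suc t} {suc m} l 1≤i i<r cl (s≤s t<m) rewrite wtc-take-raise i u l 1≤i i<r cl t<m =
  sym (ℤP.+-assoc (coord x l) (wtc (take m u) l) (root i l))

wtc-++ : ∀ {r} (u v : List (Letter r)) l → wtc (u ++ v) l ≡ wtc u l ℤ.+ wtc v l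
wtc-++ []      v l = sym (ℤP.+-identityˡ _)
wtc-++ (x ∷ u) v l rewrite wtc-++ u v l = sym (ℤP.+-assoc (coord x l) (wtc u l) (wtc v l))

card≡0⇒empty : ∀ {r} (v : Vec Bool r) → card v ≡ 0 → v ≡ replicate r false
card≡0⇒empty []          _ = refl
card≡0⇒empty (false ∷ v) c = cong (false ∷_) (card≡0⇒empty v c)

card≡1⇒singleton : ∀ {r} (v : Vec Bool r) → card v ≡ 1 →
  ∃[ c ] (1 ≤ c × c ≤ r × v ≡ upd (replicate r false) c true)
card≡1⇒singleton (true ∷ v) c =
  1 , s≤s z≤n , s≤s z≤n , cong (true ∷_) (card≡0⇒empty v (ℕP.suc-injective c))
card≡1⇒singleton (false ∷ v) c with card≡1⇒singleton v c
... | suc a , 1≤c , c≤r , refl = suc (suc a) , s≤s z≤n , s≤s c≤r , refl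

dominant-singleton : ∀ {r} (x : Letter r) → Dominant r (x ∷ []) →
  ∀ i → 1 ≤ i → i < r → coord x (suc i) ℤ.≤ coord x i
dominant-singleton x D i 1≤i i<r =
  subst₂ ℤ._≤_ (ℤP.+-identityʳ _) (ℤP.+-identityʳ _) (D i 1≤i i<r)

first-letter⁺ : ∀ {r c} {ws : List (Letter r)} → IsLatticeWord r (single⁺ r c ∷ ws) →
  1 ≤ c → c ≤ r → c ≡ 1
first-letter⁺ {c = suc zero} _ _ _ = refl
first-letter⁺ {r} {suc (suc c)} L 1≤c c≤r = contradiction (subst₂ ℤ._≤_ at-c+2 at-c+1 dominant) λ { (+≤+ ()) }
  where
    x = single⁺ r (suc (suc c))
    dominant : coord x (suc (suc c)) ℤ.≤ coord x (suc c)
    dominant = dominant-singleton x (L 1 (s≤s z≤n)) (suc c) (s≤s z≤n) c≤r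
    at-c+2 : coord x (suc (suc c)) ≡ + 1
    at-c+2 = trans (coord-single⁺ 1≤c c≤r _) (basis-same (suc (suc c)))
    at-c+1 : coord x (suc c) ≡ 0ℤ
    at-c+1 = trans (coord-single⁺ 1≤c c≤r _) (basis-other {suc (suc c)} ℕP.1+n≢n)

first-letter⁻ : ∀ {r c} {ws : List (Letter r)} → IsLatticeWord r (single⁻ r c ∷ ws) →
  1 ≤ c → c ≤ r → c ≡ r
first-letter⁻ {r} {c} L 1≤c c≤r with c ℕ.<? r
... | no c≮r = ℕP.≤-antisym c≤r (ℕP.≮⇒≥ c≮r)
... | yes c<r = contradiction (subst₂ ℤ._≤_ at-c+1 at-c dominant) λ ()
  where
    x = single⁻ r c
    dominant : coord x (suc c) ℤ.≤ coord x c
    dominant = dominant-singleton x (L 1 (s≤s z≤n)) c 1≤c c<r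
    at-c+1 : coord x (suc c) ≡ 0ℤ
    at-c+1 = trans (coord-single⁻ 1≤c c≤r _) (cong ℤ.-_ (basis-other {c} (ℕP.1+n≢n ∘ sym)))
    at-c : coord x c ≡ -1ℤ
    at-c = trans (coord-single⁻ 1≤c c≤r _) (cong ℤ.-_ (basis-same c))

balanceChain⇒sorted : ∀ {r} {w : List (Letter r)} {a ops i} → BalanceChain r w a ops i → Sorted (length w) a ops
balanceChain⇒sorted {ops = []}    _                                 = _
balanceChain⇒sorted {ops = _ ∷ _} ((a≤j , (j<n , _) , _) , chain) = a≤j , j<n , balanceChain⇒sorted chain

sorted-from-1 : ∀ {r n} {u : List (Letter r)} {ops v} → RaisingSeq r u ops v → Sorted n 0 ops → Sorted n 1 ops
sorted-from-1 done              _                = _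
sorted-from-1 (step _ _ _ _) (_ , j<n , sorted) = s≤s z≤n , j<n , sorted

-- In a rectangular word the last position is an i-balance point for every i.
rectangular⇒chain-exhausted : ∀ {r} {x : Letter r} {xs a ops i} → Rectangular r (x ∷ xs) → a < suc (length xs) →
  BalanceChain r (x ∷ xs) a ops i → ¬ (1 ≤ i × i < r)
rectangular⇒chain-exhausted {x = x} {xs} {ops = []} {i} R a<n none (1≤i , i<r) =
  none 1≤i i<r (length xs) (ℕP.≤-pred a<n)
    (ℕP.≤-refl , subst (λ v → wtc v i ≡ wtc v (suc i))
                        (sym (take-all (suc (length xs)) (x ∷ xs) ℕP.≤-refl)) (R i 1≤i i<r))
rectangular⇒chain-exhausted {ops = _ ∷ _} R _ ((_ , (j<n , _) , _) , chain) =
  rectangular⇒chain-exhausted R j<n chain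

least-below-or-none : ∀ {P : ℕ → Set} → Decidable P → ∀ n →
  (∀ t → t < n → ¬ P t) ⊎ ∃[ t ] (t < n × P t × (∀ t' → t' < t → ¬ P t'))
least-below-or-none P? zero = inj₁ λ _ ()
least-below-or-none P? (suc n) with least-below-or-none P? n
... | inj₂ (t , t<n , p , least) = inj₂ (t , ℕP.m≤n⇒m≤1+n t<n , p , least)
... | inj₁ none with P? n
...   | yes p  = inj₂ (n , ℕP.≤-refl , p , none)
...   | no ¬p = inj₁ λ t t<1+n → [ none t , (λ { refl → ¬p }) ]′ (ℕP.m<1+n⇒m<n∨m≡n t<1+n)

dip-or-none : ∀ {r} i (u : List (Letter r)) →
  (∀ t → t < length u → 0ℤ ℤ.+ depth i (take (suc t) u) ≢ -1ℤ) ⊎ ∃[ t ] FirstDip 0ℤ i u t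
dip-or-none i u = least-below-or-none (λ t → 0ℤ ℤ.+ depth i (take (suc t) u) ℤP.≟ -1ℤ) (length u)

dominant⇒depth-nonneg : ∀ {r} (u : List (Letter r)) → Dominant r u →
  ∀ {i} → 1 ≤ i → i < r → 0ℤ ℤ.≤ depth i u
dominant⇒depth-nonneg u D 1≤i i<r = ℤP.i≤j⇒0≤j-i (D _ 1≤i i<r)

depths-nonneg⇒dominant : ∀ {r} (u : List (Letter r)) →
  (∀ i → 1 ≤ i → i < r → 0ℤ ℤ.≤ depth i u) → Dominant r u
depths-nonneg⇒dominant u H i 1≤i i<r = ℤP.0≤i-j⇒j≤i (H i 1≤i i<r)

depthsAbove-unshifted : ∀ {r} {b i} {u : List (Letter r)} →
  (∀ m → m ≤ length u → b ℤ.≤ depth i (take m u)) → DepthsAbove b 0ℤ i u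
depthsAbove-unshifted H m m≤ = subst (_ ℤ.≤_) (sym (ℤP.+-identityˡ _)) (H m m≤)

0≤z+b⇒b≤0⇒0≤z : ∀ {z b} → 0ℤ ℤ.≤ z ℤ.+ b → b ℤ.≤ 0ℤ → 0ℤ ℤ.≤ z
0≤z+b⇒b≤0⇒0≤z {z} h b≤0 =
  ℤP.≤-trans h (subst (z ℤ.+ _ ℤ.≤_) (ℤP.+-identityʳ z) (ℤP.+-monoʳ-≤ z b≤0))

0≤z+1⇒-1≤z : ∀ z → 0ℤ ℤ.≤ z ℤ.+ + 1 → -1ℤ ℤ.≤ z
0≤z+1⇒-1≤z (+ n)          _ = -≤+
0≤z+1⇒-1≤z -[1+ zero ]    _ = ℤP.≤-refl
0≤z+1⇒-1≤z -[1+ suc n ] ()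

z+1≡0⇒z≡-1 : ∀ z → z ℤ.+ + 1 ≡ 0ℤ → z ≡ -1ℤ
z+1≡0⇒z≡-1 z e = trans (solve 1 (λ z → z := (z :+ con (+ 1)) :- con (+ 1)) refl z) (cong (ℤ._- + 1) e)

-- letter k is the letter standing in for w₀ after k raisings (letter 0 = w₀);
-- Reachable bounds how many raisings the ladder allows.
record Ladder (r : ℕ) : Set₁ where
  field
    letter         : ℕ → Letter r
    index          : ℕ → ℕ
    Reachable      : ℕ → Set
    opens-index    : ∀ k → 1 ≤ index k → index k < r → opens (letter k) (index k) ≡ true
    opens-other    : ∀ k l → l ≢ index k → opens (letter k) l ≡ false
    coord-next     : ∀ k → 1 ≤ index k → index k < r →
                     ∀ l → coord (letter k) l ≡ coord (letter (suc k)) l ℤ.+ root (index k) l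
    reachable-next : ∀ k → Reachable k → 1 ≤ index k → index k < r → Reachable (suc k)

  tail : Ladder r
  tail = record
    { letter         = letter ∘ suc
    ; index          = index ∘ suc
    ; Reachable      = Reachable ∘ suc
    ; opens-index    = opens-index ∘ suc
    ; opens-other    = opens-other ∘ suc
    ; coord-next     = coord-next ∘ suc
    ; reachable-next = reachable-next ∘ suc
    }

open Ladder

module Descent {r : ℕ} (w₀ : Letter r) (ws : List (Letter r)) (lattice : IsLatticeWord r (w₀ ∷ ws)) where

  w : List (Letter r)
  w = w₀ ∷ ws

  -- u is w₁ ⋯ w_{n-1} after some raisings, the last one at position a; x stands for w₀
  -- moved to the end of the word.
  record Invariant (x : Letter r) (a : ℕ) (u : List (Letter r)) : Set where
    field
      length-u        : length u ≡ length ws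
      a≤length        : a ≤ length u
      dominant-before : ∀ m → m < a → Dominant r (take m u)
      weight-from     : ∀ m → a ≤ m → m ≤ length u →
                        ∀ l → wtc (take (suc m) w) l ≡ wtc (take m u) l ℤ.+ coord x l
  open Invariant

  initial : Invariant w₀ 0 ws
  initial = record
    { length-u        = refl
    ; a≤length        = z≤n
    ; dominant-before = λ _ ()
    ; weight-from     = λ m _ _ l → ℤP.+-comm (coord w₀ l) (wtc (take m ws) l)
    }

  final-weight : ∀ {x a u} → Invariant x a u → ∀ l → wtc w l ≡ wtc (u ++ x ∷ []) l
  final-weight {x} {a} {u} I l = begin
    wtc w l                                  ≡⟨ cong (λ v → wtc v l) (sym (take-all (suc (length u)) w w≤)) ⟩
    wtc (take (suc (length u)) w) l          ≡⟨ weight-from I (length u) (a≤length I) ℕP.≤-refl l ⟩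
    wtc (take (length u) u) l ℤ.+ coord x l
      ≡⟨ cong (λ v → wtc v l ℤ.+ coord x l) (take-all (length u) u ℕP.≤-refl) ⟩
    wtc u l ℤ.+ coord x l                    ≡⟨ cong (λ c → wtc u l ℤ.+ c) (sym (ℤP.+-identityʳ (coord x l))) ⟩
    wtc u l ℤ.+ wtc (x ∷ []) l               ≡⟨ sym (wtc-++ u (x ∷ []) l) ⟩
    wtc (u ++ x ∷ []) l ∎
    where
      open ≡-Reasoning
      w≤ : length w ℕ.≤ suc (length u)
      w≤ = ℕP.≤-reflexive (cong suc (sym (length-u I)))

  depth-from : ∀ {x a u} → Invariant x a u → ∀ {m} → a ≤ m → m ≤ length u →
    ∀ i → depth i (take (suc m) w) ≡ depth i (take m u) ℤ.+ bracket x i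
  depth-from {x} {u = u} I {m} a≤m m≤ i
    rewrite weight-from I m a≤m m≤ i | weight-from I m a≤m m≤ (suc i) | bracket≡coord-difference x i =
    solve 4 (λ p q c d → (p :+ c) :- (q :+ d) := (p :- q) :+ (c :- d)) refl
      (wtc (take m u) i) (wtc (take m u) (suc i)) (coord x i) (coord x (suc i))

  lattice-depth : ∀ {m} → m ≤ length ws → ∀ {i} → 1 ≤ i → i < r → 0ℤ ℤ.≤ depth i (take (suc m) w)
  lattice-depth {m} m≤ = dominant⇒depth-nonneg (take (suc m) w) (lattice (suc _) (s≤s m≤))

  m≤length-ws : ∀ {x a u} → Invariant x a u → ∀ {m} → m ≤ length u → m ≤ length ws
  m≤length-ws I = subst (_ ≤_) (length-u I)

  depth-nonneg-other : ∀ {x a u} → Invariant x a u → ∀ {i} → 1 ≤ i → i < r → opens x i ≡ false →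
    ∀ m → m ≤ length u → 0ℤ ℤ.≤ depth i (take m u)
  depth-nonneg-other {x} {a} {u} I {i} 1≤i i<r eo m m≤ with m ℕ.<? a
  ... | yes m<a = dominant⇒depth-nonneg (take m u) (dominant-before I m m<a) 1≤i i<r
  ... | no m≮a = 0≤z+b⇒b≤0⇒0≤z
    (subst (0ℤ ℤ.≤_) (depth-from I (ℕP.≮⇒≥ m≮a) m≤ i) (lattice-depth (m≤length-ws I m≤) 1≤i i<r))
    (bracket≤0 x i eo)

  depth≥-1-index : ∀ {x a u} → Invariant x a u → ∀ {i} → 1 ≤ i → i < r → opens x i ≡ true →
    ∀ m → m ≤ length u → -1ℤ ℤ.≤ depth i (take m u)
  depth≥-1-index {x} {a} {u} I {i} 1≤i i<r eo m m≤ with m ℕ.<? a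
  ... | yes m<a = ℤP.≤-trans -≤+ (dominant⇒depth-nonneg (take m u) (dominant-before I m m<a) 1≤i i<r)
  ... | no m≮a = 0≤z+1⇒-1≤z _
    (subst (0ℤ ℤ.≤_)
      (trans (depth-from I (ℕP.≮⇒≥ m≮a) m≤ i) (cong (λ b → depth i (take m u) ℤ.+ b) (bracket-opens x i eo)))
      (lattice-depth (m≤length-ws I m≤) 1≤i i<r))

  applyE-other : ∀ {x a u} → Invariant x a u → ∀ {i} → 1 ≤ i → i < r → opens x i ≡ false →
    applyE i u ≡ nothing
  applyE-other {u = u} I {i} 1≤i i<r eo =
    applyE-no-dip i u (depthsAbove-unshifted (depth-nonneg-other I 1≤i i<r eo))

  balance⇒≤length : ∀ {x a u} → Invariant x a u → ∀ {i j} → IsBalance w i j → j ≤ length u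
  balance⇒≤length I (j<n , _) = subst (_ ≤_) (sym (length-u I)) (ℕP.≤-pred j<n)

  balance⇒dip : ∀ {x a u} → Invariant x a u → ∀ {i} → opens x i ≡ true →
    ∀ {j} → a ≤ j → IsBalance w i j → depth i (take j u) ≡ -1ℤ
  balance⇒dip {x} {u = u} I {i} eo {j} a≤j (j<n , balanced) = z+1≡0⇒z≡-1 _ (begin
    depth i (take j u) ℤ.+ + 1           ≡⟨ cong (λ b → depth i (take j u) ℤ.+ b) (sym (bracket-opens x i eo)) ⟩
    depth i (take j u) ℤ.+ bracket x i   ≡⟨ sym (depth-from I a≤j j≤ i) ⟩
    depth i (take (suc j) w)             ≡⟨ cong (ℤ._- wtc (take (suc j) w) (suc i)) balanced ⟩
    wtc (take (suc j) w) (suc i) ℤ.- wtc (take (suc j) w) (suc i)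
                                         ≡⟨ ℤP.+-inverseʳ (wtc (take (suc j) w) (suc i)) ⟩
    0ℤ ∎)
    where
      open ≡-Reasoning
      j≤ = balance⇒≤length I (j<n , balanced)

  dip⇒balance : ∀ {x a u} → Invariant x a u → ∀ {i} → opens x i ≡ true →
    ∀ {j} → a ≤ j → j ≤ length u → depth i (take j u) ≡ -1ℤ → IsBalance w i j
  dip⇒balance {x} {u = u} I {i} eo {j} a≤j j≤ dip =
    s≤s (m≤length-ws I j≤) ,
    ℤP.i-j≡0⇒i≡j _ _ (trans (depth-from I a≤j j≤ i) (cong₂ ℤ._+_ dip (bracket-opens x i eo)))

  depthsAbove-index : ∀ {x a u} → Invariant x a u → ∀ {i} → 1 ≤ i → i < r → opens x i ≡ true →
    DepthsAbove -1ℤ 0ℤ i u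
  depthsAbove-index I 1≤i i<r eo = depthsAbove-unshifted (depth≥-1-index I 1≤i i<r eo)

  applyE≡nothing⇒no-balance : ∀ {x a u} → Invariant x a u → ∀ {i} → 1 ≤ i → i < r → opens x i ≡ true →
    applyE i u ≡ nothing → ∀ j → a ≤ j → ¬ IsBalance w i j
  applyE≡nothing⇒no-balance {u = u} I {i} 1≤i i<r eo e₀ j a≤j bal with dip-or-none i u
  ... | inj₂ (t , D) =
    contradiction (trans (sym e₀) (applyE-first-dip i u t (depthsAbove-index I 1≤i i<r eo) D)) λ ()
  ... | inj₁ none = no-dip j (balance⇒≤length I bal) (balance⇒dip I eo a≤j bal)
    where
      no-dip : ∀ j → j ≤ length u → depth i (take j u) ≢ -1ℤ
      no-dip zero    _  ()
      no-dip (suc t) t< = none t t< ∘ trans (ℤP.+-identityˡ _)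

  applyE≡just⇒first-dip : ∀ {x a u} → Invariant x a u → ∀ {i} → 1 ≤ i → i < r → opens x i ≡ true →
    ∀ {p u'} → applyE i u ≡ just (p , u') → FirstDip 0ℤ i u p × u' ≡ modifyAt p (raiseLetter i) u
  applyE≡just⇒first-dip {u = u} I {i} 1≤i i<r eo e with dip-or-none i u
  ... | inj₁ none = contradiction (trans (sym e) (applyE-no-dip i u (depthsAbove-unshifted nonneg))) λ ()
    where
      nonneg : ∀ m → m ≤ length u → 0ℤ ℤ.≤ depth i (take m u)
      nonneg zero    _  = ℤP.≤-refl
      nonneg (suc t) t< =
        -1≤z⇒z≢-1⇒0≤z _ (depth≥-1-index I 1≤i i<r eo (suc t) t<) (none t t< ∘ trans (ℤP.+-identityˡ _))
  ... | inj₂ (t , D) with just-injective (trans (sym e) (applyE-first-dip i u t (depthsAbove-index I 1≤i i<r eo) D))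
  ...   | refl = D , refl

  first-dip⇒first-balance : ∀ {x a u} → Invariant x a u → ∀ {i} → 1 ≤ i → i < r → opens x i ≡ true →
    ∀ {t} → FirstDip 0ℤ i u t → FirstBalanceAfter w i a (suc t)
  first-dip⇒first-balance {x} {a} {u} I {i} 1≤i i<r eo {t} (t< , dip , before) =
    a≤1+t , dip⇒balance I eo a≤1+t t< dip′ , not-before
    where
      dip′ : depth i (take (suc t) u) ≡ -1ℤ
      dip′ = trans (sym (ℤP.+-identityˡ _)) dip
      a≤1+t : a ≤ suc t
      a≤1+t with suc t ℕ.<? a
      ... | no 1+t≮a = ℕP.≮⇒≥ 1+t≮a
      ... | yes 1+t<a = contradiction
        (subst (0ℤ ℤ.≤_) dip′
          (dominant⇒depth-nonneg (take (suc t) u) (dominant-before I (suc t) 1+t<a) 1≤i i<r)) λ ()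
      not-before : ∀ j → a ≤ j → j < suc t → ¬ IsBalance w i j
      not-before zero     a≤j _          bal with balance⇒dip I eo a≤j bal
      ... | ()
      not-before (suc t') a≤j (s≤s t'<t) bal = before t' t'<t (trans (ℤP.+-identityˡ _) (balance⇒dip I eo a≤j bal))

  invariant-after-raise : ∀ {x a u} → Invariant x a u → ∀ {i} → 1 ≤ i → i < r → opens x i ≡ true →
    (∀ l → l ≢ i → opens x l ≡ false) → ∀ {t} → FirstDip 0ℤ i u t →
    ∀ {x'} → (∀ l → coord x l ≡ coord x' l ℤ.+ root i l) → Invariant x' (suc t) (modifyAt t (raiseLetter i) u)
  invariant-after-raise {x} {a} {u} I {i} 1≤i i<r eo others {t} D {x'} x≡x'+α = record
    { length-u        = trans length-u′ (length-u I)
    ; a≤length        = subst (suc t ≤_) (sym length-u′) (proj₁ D)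
    ; dominant-before = dominant-before′
    ; weight-from     = weight-from′
    }
    where
      u′ = modifyAt t (raiseLetter i) u
      length-u′ : length u′ ≡ length u
      length-u′ = length-modifyAt (raiseLetter i) u t
      H : DepthsAbove -1ℤ 0ℤ i u
      H = depthsAbove-index I 1≤i i<r eo
      dominant-before′ : ∀ m → m < suc t → Dominant r (take m u′)
      dominant-before′ m (s≤s m≤t) rewrite take-modifyAt (raiseLetter i) u m≤t =
        depths-nonneg⇒dominant (take m u) nonneg
        where
          nonneg : ∀ l → 1 ≤ l → l < r → 0ℤ ℤ.≤ depth l (take m u)
          nonneg l 1≤l l<r with l ℕ.≟ i
          ... | yes refl = subst (0ℤ ℤ.≤_) (ℤP.+-identityˡ _) (firstDip-nonneg-before H D m m≤t)
          ... | no l≢i = depth-nonneg-other I 1≤l l<r (others l l≢i) m (ℕP.≤-trans m≤t (ℕP.<⇒≤ (proj₁ D)))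
      weight-from′ : ∀ m → suc t ≤ m → m ≤ length u′ →
        ∀ l → wtc (take (suc m) w) l ≡ wtc (take m u′) l ℤ.+ coord x' l
      weight-from′ m t<m m≤ l = begin
        wtc (take (suc m) w) l                         ≡⟨ weight-from I m a≤m (subst (m ≤_) length-u′ m≤) l ⟩
        wtc (take m u) l ℤ.+ coord x l                 ≡⟨ cong (λ c → wtc (take m u) l ℤ.+ c) (x≡x'+α l) ⟩
        wtc (take m u) l ℤ.+ (coord x' l ℤ.+ root i l) ≡⟨ solve 3 (λ p c α → p :+ (c :+ α) := (p :+ α) :+ c) refl
                                                             (wtc (take m u) l) (coord x' l) (root i l) ⟩
        (wtc (take m u) l ℤ.+ root i l) ℤ.+ coord x' l
          ≡⟨ cong (ℤ._+ coord x' l) (sym (wtc-take-raise i u l 1≤i i<r (firstDip-closes i u t H D) t<m)) ⟩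
        wtc (take m u′) l ℤ.+ coord x' l ∎
        where
          open ≡-Reasoning
          a≤m : a ≤ m
          a≤m = ℕP.≤-trans (proj₁ (first-dip⇒first-balance I 1≤i i<r eo D)) t<m

  descent : ∀ (L : Ladder r) {a u ops v} → Invariant (letter L 0) a u → Reachable L 0 →
    RaisingSeq r u ops v → HighestWeight r v →
    map proj₁ ops ≡ applyUpTo (index L) (length ops)
    × Reachable L (length ops)
    × WtEq r w (v ++ letter L (length ops) ∷ [])
    × BalanceChain r w a ops (index L (length ops))
  descent L I reachable done highest =
    refl , reachable , (λ l _ _ → final-weight I l) ,
    λ 1≤i i<r → applyE≡nothing⇒no-balance I 1≤i i<r (opens-index L 0 1≤i i<r) (highest _ 1≤i i<r)
  descent L I reachable (step {i = i} 1≤i i<r e rest) highest with i ℕ.≟ index L 0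
  ... | no i≢i₀ = contradiction (trans (sym e) (applyE-other I 1≤i i<r (opens-other L 0 i i≢i₀))) λ ()
  ... | yes refl with applyE≡just⇒first-dip I 1≤i i<r (opens-index L 0 1≤i i<r) e
  ...   | D , refl =
    let I′ = invariant-after-raise I 1≤i i<r (opens-index L 0 1≤i i<r) (opens-other L 0) D (coord-next L 0 1≤i i<r)
        indices , reachable′ , weight , chain = descent (tail L) I′ (reachable-next L 0 reachable 1≤i i<r) rest highest
    in cong (i ∷_) indices , reachable′ , weight ,
       first-dip⇒first-balance I 1≤i i<r (opens-index L 0 1≤i i<r) D , chain

ladder-descent : ∀ {r} (L : Ladder r) (ws : List (Letter r)) {ops w'} → IsLatticeWord r (letter L 0 ∷ ws) →
  Reachable L 0 → RaisingSeq r ws ops w' → HighestWeight r w' →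
  map proj₁ ops ≡ map (index L) (upTo (length ops))
  × Reachable L (length ops)
  × WtEq r (letter L 0 ∷ ws) (w' ++ letter L (length ops) ∷ [])
  × BalanceChain r (letter L 0 ∷ ws) 0 ops (index L (length ops))
  × Sorted (suc (length ws)) 1 ops
  × (Rectangular r (letter L 0 ∷ ws) → ¬ (1 ≤ index L (length ops) × index L (length ops) < r))
ladder-descent L ws {ops} lattice reachable raising highest =
  let indices , reachable′ , weight , chain = descent L initial reachable raising highest
  in trans indices (sym (map-applyUpTo (λ k → k) (index L) (length ops))) , reachable′ , weight , chain ,
     sorted-from-1 raising (balanceChain⇒sorted chain) , λ R → rectangular⇒chain-exhausted R (s≤s z≤n) chain
  where open Descent (letter L 0) ws lattice

opens-single⁺ : ∀ {r a} → 1 ≤ a → a < r → opens (single⁺ r a) a ≡ true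
opens-single⁺ {r} {a} 1≤a a<r
  rewrite mem-upd-same (replicate r false) a true 1≤a (ℕP.<⇒≤ a<r)
        | mem-upd-other (replicate r false) a true (suc a) (ℕP.1+n≢n ∘ sym) | mem-replicate r (suc a) = refl

opens-single⁺-other : ∀ {r a l} → l ≢ a → opens (single⁺ r a) l ≡ false
opens-single⁺-other {r} {a} {l} l≢a
  rewrite mem-upd-other (replicate r false) a true l (l≢a ∘ sym) | mem-replicate r l = refl

opens-single⁻ : ∀ {r a} → suc a ≤ r → opens (single⁻ r (suc a)) a ≡ true
opens-single⁻ {r} {a} a<r
  rewrite mem-upd-same (replicate r false) (suc a) true (s≤s z≤n) a<r
        | mem-upd-other (replicate r false) (suc a) true a ℕP.1+n≢n | mem-replicate r a = refl

opens-single⁻-other : ∀ {r a l} → suc l ≢ a → opens (single⁻ r a) l ≡ false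
opens-single⁻-other {r} {a} {l} 1+l≢a
  rewrite mem-upd-other (replicate r false) a true (suc l) (1+l≢a ∘ sym) | mem-replicate r (suc l) = refl

ascending : ∀ r → Ladder r
ascending r = record
  { letter         = λ k → single⁺ r (suc k)
  ; index          = suc
  ; Reachable      = λ k → suc k ≤ r
  ; opens-index    = λ _ → opens-single⁺
  ; opens-other    = λ k _ → opens-single⁺-other {r} {suc k}
  ; coord-next     = coord-next⁺
  ; reachable-next = λ _ _ _ k+1<r → k+1<r
  }
  where
    coord-next⁺ : ∀ k → 1 ≤ suc k → suc k < r →
      ∀ l → coord (single⁺ r (suc k)) l ≡ coord (single⁺ r (suc (suc k))) l ℤ.+ root (suc k) l
    coord-next⁺ k _ k+1<r l
      rewrite coord-single⁺ (s≤s z≤n) (ℕP.<⇒≤ k+1<r) l | coord-single⁺ (s≤s z≤n) k+1<r l =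
      solve 2 (λ a b → a := b :+ (a :- b)) refl (basis (suc k) l) (basis (suc (suc k)) l)

∸-suc : ∀ r k → 1 ≤ r ∸ suc k → r ∸ k ≡ suc (r ∸ suc k)
∸-suc (suc r) zero    _ = refl
∸-suc (suc r) (suc k) h = ∸-suc r k h

descending : ∀ r → Ladder r
descending r = record
  { letter         = λ k → single⁻ r (r ∸ k)
  ; index          = λ k → r ∸ suc k
  ; Reachable      = λ k → 1 ≤ r ∸ k
  ; opens-index    = opens-index⁻
  ; opens-other    = λ k l l≢i →
      opens-single⁻-other {r} {r ∸ k} λ e → l≢i (trans (cong ℕ.pred e) (ℕP.pred[m∸n]≡m∸[1+n] r k))
  ; coord-next     = coord-next⁻
  ; reachable-next = λ _ _ 1≤i _ → 1≤i
  }
  where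
    opens-index⁻ : ∀ k → 1 ≤ r ∸ suc k → r ∸ suc k < r → opens (single⁻ r (r ∸ k)) (r ∸ suc k) ≡ true
    opens-index⁻ k 1≤i _ rewrite ∸-suc r k 1≤i =
      opens-single⁻ (subst (_≤ r) (∸-suc r k 1≤i) (ℕP.m∸n≤m r k))
    coord-next⁻ : ∀ k → 1 ≤ r ∸ suc k → r ∸ suc k < r →
      ∀ l → coord (single⁻ r (r ∸ k)) l ≡ coord (single⁻ r (r ∸ suc k)) l ℤ.+ root (r ∸ suc k) l
    coord-next⁻ k 1≤i i<r l rewrite ∸-suc r k 1≤i
      | coord-single⁻ (s≤s z≤n) (subst (_≤ r) (∸-suc r k 1≤i) (ℕP.m∸n≤m r k)) l
      | coord-single⁻ 1≤i (ℕP.<⇒≤ i<r) l =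
      solve 2 (λ a b → :- b := :- a :+ (a :- b)) refl (basis (r ∸ suc k) l) (basis (suc (r ∸ suc k)) l)

ascending-exhausted : ∀ {r n} → suc n ≤ r → ¬ (1 ≤ suc n × suc n < r) → n ≡ r ∸ 1
ascending-exhausted n<r out = cong (_∸ 1) (ℕP.≤-antisym n<r (ℕP.≮⇒≥ λ n+1<r → out (s≤s z≤n , n+1<r)))

descending-exhausted : ∀ {r k} → 1 ≤ r ∸ k → ¬ (1 ≤ r ∸ suc k × r ∸ suc k < r) → k ≡ r ∸ 1
descending-exhausted {r} {k} 1≤r∸k out
  with ℕP.m∸n≢0⇒n<m {r} {k} (λ r∸k≡0 → contradiction (subst (1 ≤_) r∸k≡0 1≤r∸k) λ ()) | r ∸ suc k in e
... | k<r | zero  = cong (_∸ 1) (sym (ℕP.≤-antisym (ℕP.m∸n≡0⇒m≤n e) k<r))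
... | k<r | suc _ = contradiction (subst (1 ≤_) (sym e) (s≤s z≤n) , ℕP.∸-monoʳ-< (s≤s z≤n) k<r) out

proposition8p22 : (r : ℕ) (w₀ : Letter r) (ws : List (Letter r))
    → IsLatticeWord r (w₀ ∷ ws)
    → card (proj₂ w₀) ≡ 1
    → (ops : List (ℕ × ℕ)) (w' : List (Letter r))
    → RaisingSeq r ws ops w'
    → HighestWeight r w'
    → ((proj₁ w₀ ≡ true)
         → map proj₁ ops ≡ map suc (upTo (length ops))
         × length ops + 1 ≤ r
         × WtEq r (w₀ ∷ ws) (w' ++ (single⁺ r (length ops + 1) ∷ []))
         × BalanceChain r (w₀ ∷ ws) 0 ops (length ops + 1))
    × ((proj₁ w₀ ≡ false)
         → map proj₁ ops ≡ map (λ h → r ∸ suc h) (upTo (length ops))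
         × 1 ≤ r ∸ length ops
         × WtEq r (w₀ ∷ ws) (w' ++ (single⁻ r (r ∸ length ops) ∷ []))
         × BalanceChain r (w₀ ∷ ws) 0 ops (r ∸ length ops ∸ 1))
    × Sorted (suc (length ws)) 1 ops
    × (Rectangular r (w₀ ∷ ws) → length ops ≡ r ∸ 1)
proposition8p22 r (s , v) ws lattice card≡1 ops w' raising highest with card≡1⇒singleton v card≡1
proposition8p22 r (true , _) ws lattice _ ops w' raising highest | c , 1≤c , c≤r , refl
  with first-letter⁺ lattice 1≤c c≤r
... | refl with ladder-descent (ascending r) ws lattice c≤r raising highest
...   | indices , reachable , weight , chain , sorted , rectangular =
  (λ _ → subst (λ n → map proj₁ ops ≡ map suc (upTo (length ops)) × n ≤ r
                       × WtEq r (single⁺ r 1 ∷ ws) (w' ++ single⁺ r n ∷ [])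
                       × BalanceChain r (single⁺ r 1 ∷ ws) 0 ops n)
                (ℕP.+-comm 1 (length ops)) (indices , reachable , weight , chain)) ,
  (λ ()) , sorted , ascending-exhausted reachable ∘ rectangular
proposition8p22 r (false , _) ws lattice _ ops w' raising highest | c , 1≤c , c≤r , refl
  with first-letter⁻ lattice 1≤c c≤r
... | refl with ladder-descent (descending r) ws lattice 1≤c raising highest
...   | indices , reachable , weight , chain , sorted , rectangular =
  (λ ()) ,
  (λ _ → indices , reachable , weight ,
         subst (BalanceChain r (single⁻ r r ∷ ws) 0 ops) (sym (ℕP.pred[m∸n]≡m∸[1+n] r (length ops))) chain) ,
  sorted , descending-exhausted reachable ∘ rectangular
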